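{- Let $G$ be a graph of order $n$, vertex connectivity $\kappa$ and independence number $\alpha$. If $\kappa+\alpha=n$, then $\mathrm{th}_{\mathrm{H}}(G)=\lceil 2\sqrt{n-\kappa}+\kappa-1\rceil=\lceil n-\alpha+2\sqrt{\alpha}-1\rceil$.
   Context: All graphs are finite, simple and undirected; $N(v)$ is the open neighborhood of $v$. Vertices are colored blue or white. Under the hopping color change rule, a blue vertex $v$ may force a white vertex $w$ (not necessarily adjacent to $v$) to become blue provided $v$ has not previously performed a force and every vertex of $N(v)$ is blue. Starting from an initial blue set $B\subseteq V(G)$, a chronological list of forces is a sequence of valid forces performed one at a time until no further force is possible; its unordered set of forces is a set of forces of $B$. $B$ is a hopping forcing set if some chronological list turns every vertex blue. For a set of forces $\mathcal F$ of $B$, put $\mathcal F^{(0)}=B$ and, for $t>0$, let $\mathcal F^{(t)}$ be the set of vertices $w$ for which there is a force $v\to w$ in $\mathcal F$ with $v\in\bigcup_{i<t}\mathcal F^{(i)}$ that is a valid hopping force when exactly the vertices of $\bigcup_{i<t}\mathcal F^{(i)}$ are blue. $\mathrm{pt}_{\mathrm{H}}(G;\mathcal F)$ is the least $t$ with $\bigcup_{i\le t}\mathcal F^{(i)}=V(G)$, and $\mathrm{pt}_{\mathrm{H}}(G;B)$ is the minimum of $\mathrm{pt}_{\mathrm{H}}(G;\mathcal F)$ over sets of forces $\mathcal F$ of $B$ ($\infty$ if $B$ is not a hopping forcing set). The hopping throttling number is $\mathrm{th}_{\mathrm{H}}(G)=\min_{B\subseteq V(G)}\big(|B|+\mathrm{pt}_{\mathrm{H}}(G;B)\big)$.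 -}

module Defs where

open import Data.Nat using (ℕ; zero; suc; _+_; _*_; _≤_)
open import Data.Bool using (Bool; true; false)
open import Data.Fin using (Fin)
open import Data.Fin.Subset using (Subset; inside; ∁; ∣_∣) renaming (_∈_ to _∈ₛ_; _∉_ to _∉ₛ_)
open import Data.Vec using (_[_]≔_)
open import Data.List using (List; []; _∷_)
open import Data.List.Membership.Propositional using (_∈_; _∉_)
open import Data.Product using (Σ; ∃; ∃-syntax; _×_; _,_)
open import Data.Sum using (_⊎_)
open import Relation.Nullary using (¬_)
open import Relation.Binary.PropositionalEquality using (_≡_)

record Graph (n : ℕ) : Set where
  field
    adj     : Fin n → Fin n → Bool
    symm    : ∀ u v → adj u v ≡ adj v u
    irrefl  : ∀ v → adj v v ≡ false
open Graph public

module _ {n : ℕ} (G : Graph n) where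

  Independent : Subset n → Set
  Independent S = ∀ u v → u ∈ₛ S → v ∈ₛ S → adj G u v ≡ false

  IndependenceNumber : ℕ → Set
  IndependenceNumber a =
    (Σ (Subset n) λ S → Independent S × ∣ S ∣ ≡ a) ×
    (∀ S → Independent S → ∣ S ∣ ≤ a)

  -- Vertex connectivity
  -- Reach S u v : there is a walk from u to v in G - S (u itself assumed outside S).
  data Reach (S : Subset n) : Fin n → Fin n → Set where
    here : ∀ {u} → Reach S u u
    step : ∀ {u w v} → adj G u w ≡ true → w ∉ₛ S → Reach S w v → Reach S u v

  Separating : Subset n → Set
  Separating S =
    (Σ (Fin n) λ u → Σ (Fin n) λ v → u ∉ₛ S × v ∉ₛ S × ¬ Reach S u v)
    ⊎ (∣ ∁ S ∣ ≤ 1)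

  VertexConnectivity : ℕ → Set
  VertexConnectivity k =
    (Σ (Subset n) λ S → Separating S × ∣ S ∣ ≡ k) ×
    (∀ S → Separating S → k ≤ ∣ S ∣)

  -- Hopping forcing
  -- A valid hopping force v → w when S is the blue set and `used` lists
  -- the vertices that have already performed a force.
  ValidForce : Subset n → List (Fin n) → Fin n → Fin n → Set
  ValidForce S used v w =
    v ∈ₛ S × v ∉ used × (∀ u → adj G v u ≡ true → u ∈ₛ S) × w ∉ₛ S

  data Chron : Subset n → List (Fin n) → List (Fin n × Fin n) → Set where
    done : ∀ {S used} → (∀ v w → ¬ ValidForce S used v w) → Chron S used []
    step : ∀ {S used v w L} → ValidForce S used v w →
           Chron (S [ w ]≔ inside) (v ∷ used) L → Chron S used ((v , w) ∷ L)

  -- L is a chronological list of forces of B (its set of forces is the set of entries of L).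
  ChronListOf : Subset n → List (Fin n × Fin n) → Set
  ChronListOf B L = Chron B [] L

  -- BlueBy B L t w : w ∈ F^(0) ∪ ... ∪ F^(t), where F is the set of forces of L.
  BlueBy : Subset n → List (Fin n × Fin n) → ℕ → Fin n → Set
  BlueBy B L zero w = w ∈ₛ B
  BlueBy B L (suc t) w =
    BlueBy B L t w ⊎
    (Σ (Fin n) λ v → (v , w) ∈ L × BlueBy B L t v ×
       (∀ u → adj G v u ≡ true → BlueBy B L t u) × ¬ BlueBy B L t w)

  CompletesBy : Subset n → List (Fin n × Fin n) → ℕ → Set
  CompletesBy B L t = ∀ w → BlueBy B L t w

  HoppingThrottling : ℕ → Set
  HoppingThrottling k =
    (Σ (Subset n) λ B → Σ (List (Fin n × Fin n)) λ L → Σ ℕ λ t →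
        ChronListOf B L × CompletesBy B L t × ∣ B ∣ + t ≡ k) ×
    (∀ B L t → ChronListOf B L → CompletesBy B L t → k ≤ ∣ B ∣ + t)

-- CeilTwoSqrt m c : c = ⌈ 2 √m ⌉, i.e. c is the least natural with 4m ≤ c².
CeilTwoSqrt : ℕ → ℕ → Set
CeilTwoSqrt m c = (4 * m ≤ c * c) × (∀ k → 4 * m ≤ k * k → c ≤ k)

-- Let m r be the number of white vertices after round r and d = α ∸ m 0, which
-- is ∣B∣ − κ. A vertex turned blue by round r + 1 was forced by a vertex that is blue, with all
-- neighbours blue, after round r; distinct targets have distinct forcers. Such "saturated"
-- vertices and the white vertices are separated by the remaining vertices, so they number at
-- most n − κ = α together. Hence (m 0 − m (r + 1)) + m r ≤ α, i.e. m r ≤ m (r + 1) + d, so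
-- m 0 ≤ t d, α ≤ (t + 1) d, and AM–GM gives ⌈2√α⌉ ≤ d + t + 1, i.e. ⌈2√α⌉ + κ − 1 ≤ ∣B∣ + t.
--
-- List a maximum independent set as x₀, …, x_{α−1}, let B be everything outside
-- it together with x₀, …, x_{b−1}, and let x_i force x_{i+b}. Every forcer has only initially
-- blue neighbours, so each round turns b further vertices blue; b = ⌊c/2⌋ and t + 1 = ⌈c/2⌉,
-- where c = ⌈2√α⌉, give α ≤ (t + 1) b and ∣B∣ + t = κ + c − 1.
module Submission where

open import Defs
import Data.Bool as Bool
open import Data.Bool using (true; false)
open import Data.Fin using (Fin; zero; suc; _≟_; fromℕ<)
open import Data.Fin.Properties using (any?; all?)
open import Data.Fin.Subset
  using (Subset; inside; outside; ∁; _∪_; _∩_; ⁅_⁆; ∣_∣; Nonempty; Empty; _⊆_)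
  renaming (⊥ to ∅; _∈_ to _∈ₛ_; _∉_ to _∉ₛ_)
open import Data.Fin.Subset.Properties
  using ( _∈?_; nonempty?; Empty-unique; ∉⊥; ∣⊥∣≡0; ∣p∣≤n; ∣⁅x⁆∣≡1; ∣∁p∣≡n∸∣p∣; p⊆q⇒∣p∣≤∣q∣
        ; ⊆-antisym; x∈⁅x⁆; x∈⁅y⁆⇒x≡y; x∈p∩q⁻; x∈p∪q⁺; x∈p∪q⁻
        ; x∈p⇒x∉∁p; x∈∁p⇒x∉p; x∉p⇒x∈∁p; x∉∁p⇒x∈p)
open import Data.List using (List; []; _∷_; length; map; filter; take; drop; zip; allFin)
open import Data.List.Membership.Propositional using (_∈_; _∉_)
open import Data.List.Membership.Propositional.Properties
  using (∈-map⁺; ∈-map⁻; ∈-filter⁺; ∈-filter⁻; ∈-allFin; ∈-++⁺ˡ; ∈-++⁺ʳ)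
open import Data.List.Properties using (take++drop≡id; length-drop; take-all; length-map)
import Data.List.Relation.Unary.All as All
open import Data.List.Relation.Unary.AllPairs using (AllPairs; []; _∷_)
import Data.List.Relation.Unary.AllPairs.Properties as AllPairs
open import Data.List.Relation.Unary.Any using (here; there)
open import Data.List.Relation.Unary.Unique.Propositional using (Unique)
open import Data.List.Relation.Unary.Unique.Propositional.Properties
  using (Unique[x∷xs]⇒x∉xs; drop⁺; filter⁺; allFin⁺)
open import Data.Nat using (ℕ; zero; suc; _+_; _*_; _∸_; _≤_; _<_; z≤n; s≤s; _≤?_)
open import Data.Nat.Properties
  using ( +-assoc; +-comm; +-suc; +-identityʳ; +-commutativeSemigroup; +-cancelʳ-≡; +-cancelˡ-≤
        ; +-monoʳ-≤; +-monoˡ-≤; +-∸-assoc; *-comm; *-suc; *-identityˡ; *-zeroʳ; *-monoʳ-≤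
        ; *-cancelˡ-≤; ≤-trans; ≤-reflexive; ≤-total; ≤-pred; <⇒≤; ≰⇒>; ∸-monoˡ-≤
        ; m≤m+n; m≤n+m; m≤n+m∸n; m+[n∸m]≡n; m∸n+n≡m; m+n∸m≡n; m+n∸n≡m; m∸n≤m
        ; m∸[m∸n]≡n; m≤n⇒m∸n≡0; m+n≤o⇒m≤o∸n; m≤n+o⇒m∸n≤o; m≤o∸n⇒m+n≤o; module ≤-Reasoning)
open import Algebra.Properties.CommutativeSemigroup +-commutativeSemigroup
  using (x∙yz≈y∙zx; x∙yz≈y∙xz)
open import Data.Nat.Tactic.RingSolver using (solve-∀)
open import Data.Product using (Σ; ∃-syntax; _×_; _,_; proj₁; proj₂)
open import Data.Product.Properties using (≡-dec)
open import Data.Sum using (_⊎_; inj₁; inj₂; [_,_]′)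
open import Data.Vec using ([]; _∷_; tabulate; _[_]≔_; here; there)
open import Data.Vec.Properties
  using (lookup∘tabulate; []=⇒lookup; lookup⇒[]=; []≔-updates; []≔-minimal)
open import Function using (_∘_; _on_)
open import Relation.Nullary using (¬_; yes; no; does; contradiction)
open import Relation.Nullary.Decidable using (dec-true; _×-dec_; _⊎-dec_; _→-dec_; ¬?)
open import Relation.Unary using (Pred; Decidable)
open import Relation.Binary.PropositionalEquality

∣p∪q∣+∣p∩q∣≡∣p∣+∣q∣ : ∀ {n} (p q : Subset n) → ∣ p ∪ q ∣ + ∣ p ∩ q ∣ ≡ ∣ p ∣ + ∣ q ∣
∣p∪q∣+∣p∩q∣≡∣p∣+∣q∣ []            []            = refl
∣p∪q∣+∣p∩q∣≡∣p∣+∣q∣ (outside ∷ p) (outside ∷ q) = ∣p∪q∣+∣p∩q∣≡∣p∣+∣q∣ p q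
∣p∪q∣+∣p∩q∣≡∣p∣+∣q∣ (inside  ∷ p) (outside ∷ q) = cong suc (∣p∪q∣+∣p∩q∣≡∣p∣+∣q∣ p q)
∣p∪q∣+∣p∩q∣≡∣p∣+∣q∣ (outside ∷ p) (inside  ∷ q) =
  trans (cong suc (∣p∪q∣+∣p∩q∣≡∣p∣+∣q∣ p q)) (sym (+-suc ∣ p ∣ ∣ q ∣))
∣p∪q∣+∣p∩q∣≡∣p∣+∣q∣ (inside  ∷ p) (inside  ∷ q) =
  cong suc (trans (+-suc ∣ p ∪ q ∣ ∣ p ∩ q ∣)
                  (trans (cong suc (∣p∪q∣+∣p∩q∣≡∣p∣+∣q∣ p q)) (sym (+-suc ∣ p ∣ ∣ q ∣))))

∣p∪q∣≤∣p∣+∣q∣ : ∀ {n} (p q : Subset n) → ∣ p ∪ q ∣ ≤ ∣ p ∣ + ∣ q ∣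
∣p∪q∣≤∣p∣+∣q∣ p q = subst (∣ p ∪ q ∣ ≤_) (∣p∪q∣+∣p∩q∣≡∣p∣+∣q∣ p q) (m≤m+n _ _)

∣p∪q∣≡∣p∣+∣q∣ : ∀ {n} (p q : Subset n) → (∀ {x} → x ∈ₛ p → x ∉ₛ q) → ∣ p ∪ q ∣ ≡ ∣ p ∣ + ∣ q ∣
∣p∪q∣≡∣p∣+∣q∣ {n} p q disjoint = begin
  ∣ p ∪ q ∣              ≡⟨ sym (trans (cong (∣ p ∪ q ∣ +_) (∣⊥∣≡0 n)) (+-identityʳ _)) ⟩
  ∣ p ∪ q ∣ + ∣ ∅ {n} ∣  ≡⟨ cong (λ r → ∣ p ∪ q ∣ + ∣ r ∣) (sym (Empty-unique p∩q-empty)) ⟩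
  ∣ p ∪ q ∣ + ∣ p ∩ q ∣  ≡⟨ ∣p∪q∣+∣p∩q∣≡∣p∣+∣q∣ p q ⟩
  ∣ p ∣ + ∣ q ∣          ∎
  where
  open ≡-Reasoning
  p∩q-empty : Empty (p ∩ q)
  p∩q-empty (x , x∈p∩q) = let (x∈p , x∈q) = x∈p∩q⁻ p q x∈p∩q in disjoint x∈p x∈q

∣p∣+∣∁p∣≡n : ∀ {n} (p : Subset n) → ∣ p ∣ + ∣ ∁ p ∣ ≡ n
∣p∣+∣∁p∣≡n p = trans (cong (∣ p ∣ +_) (∣∁p∣≡n∸∣p∣ p)) (m+[n∸m]≡n (∣p∣≤n p))

0<∣p∣⇒Nonempty : ∀ {n} (p : Subset n) → 0 < ∣ p ∣ → Nonempty p
0<∣p∣⇒Nonempty {n} p 0<∣p∣ with nonempty? p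
... | yes nonempty = nonempty
... | no  empty    = contradiction (subst (λ r → 0 < ∣ r ∣) (Empty-unique empty) 0<∣p∣)
                                   (subst (λ k → ¬ 0 < k) (sym (∣⊥∣≡0 n)) λ ())

module _ {n : ℕ} {ℓ} {P : Pred (Fin n) ℓ} where

  ⟦_⟧ : Decidable P → Subset n
  ⟦ P? ⟧ = tabulate (λ x → does (P? x))

  ∈⟦⟧⁺ : (P? : Decidable P) {x : Fin n} → P x → x ∈ₛ ⟦ P? ⟧
  ∈⟦⟧⁺ P? {x} px = lookup⇒[]= x _ (trans (lookup∘tabulate _ x) (dec-true (P? x) px))

  ∈⟦⟧⁻ : (P? : Decidable P) {x : Fin n} → x ∈ₛ ⟦ P? ⟧ → P x
  ∈⟦⟧⁻ P? {x} x∈ with P? x | trans (sym (lookup∘tabulate _ x)) ([]=⇒lookup x∈)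
  ... | yes px | _ = px
  ... | no  _  | ()

fromList : ∀ {n} → List (Fin n) → Subset n
fromList []       = ∅
fromList (y ∷ ys) = ⁅ y ⁆ ∪ fromList ys

module _ {n : ℕ} where

  ∈-fromList⁺ : ∀ {x : Fin n} {ys} → x ∈ ys → x ∈ₛ fromList ys
  ∈-fromList⁺ (here refl) = x∈p∪q⁺ (inj₁ (x∈⁅x⁆ _))
  ∈-fromList⁺ (there x∈)  = x∈p∪q⁺ (inj₂ (∈-fromList⁺ x∈))

  ∈-fromList⁻ : ∀ {x : Fin n} ys → x ∈ₛ fromList ys → x ∈ ys
  ∈-fromList⁻ []       x∈ = contradiction x∈ ∉⊥
  ∈-fromList⁻ (y ∷ ys) x∈ with x∈p∪q⁻ ⁅ y ⁆ (fromList ys) x∈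
  ... | inj₁ x∈⁅y⁆ = here (x∈⁅y⁆⇒x≡y y x∈⁅y⁆)
  ... | inj₂ x∈ys  = there (∈-fromList⁻ ys x∈ys)

  ∣fromList∣≤length : (ys : List (Fin n)) → ∣ fromList ys ∣ ≤ length ys
  ∣fromList∣≤length []       = ≤-reflexive (∣⊥∣≡0 n)
  ∣fromList∣≤length (y ∷ ys) = begin
    ∣ ⁅ y ⁆ ∪ fromList ys ∣      ≤⟨ ∣p∪q∣≤∣p∣+∣q∣ ⁅ y ⁆ (fromList ys) ⟩
    ∣ ⁅ y ⁆ ∣ + ∣ fromList ys ∣  ≡⟨ cong (_+ ∣ fromList ys ∣) (∣⁅x⁆∣≡1 y) ⟩
    suc ∣ fromList ys ∣          ≤⟨ s≤s (∣fromList∣≤length ys) ⟩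
    suc (length ys)              ∎
    where open ≤-Reasoning

  ∣fromList∣≡length : {ys : List (Fin n)} → Unique ys → ∣ fromList ys ∣ ≡ length ys
  ∣fromList∣≡length {[]}     _                   = ∣⊥∣≡0 n
  ∣fromList∣≡length {y ∷ ys} u@(_ ∷ ys-unique) = begin
    ∣ ⁅ y ⁆ ∪ fromList ys ∣      ≡⟨ ∣p∪q∣≡∣p∣+∣q∣ ⁅ y ⁆ (fromList ys) y∉ys ⟩
    ∣ ⁅ y ⁆ ∣ + ∣ fromList ys ∣  ≡⟨ cong₂ _+_ (∣⁅x⁆∣≡1 y) (∣fromList∣≡length ys-unique) ⟩
    suc (length ys)              ∎
    where
    open ≡-Reasoning
    y∉ys : ∀ {x} → x ∈ₛ ⁅ y ⁆ → x ∉ₛ fromList ys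
    y∉ys x∈⁅y⁆ x∈ys with x∈⁅y⁆⇒x≡y y x∈⁅y⁆
    ... | refl = Unique[x∷xs]⇒x∉xs u (∈-fromList⁻ ys x∈ys)

∈-update⁻ : ∀ {n} (p : Subset n) {x} y → x ∈ₛ p [ y ]≔ inside → x ≡ y ⊎ x ∈ₛ p
∈-update⁻ (s ∷ p) {zero}  zero    _           = inj₁ refl
∈-update⁻ (s ∷ p) {zero}  (suc y) here        = inj₂ here
∈-update⁻ (s ∷ p) {suc x} zero    (there x∈p) = inj₂ (there x∈p)
∈-update⁻ (s ∷ p) {suc x} (suc y) (there x∈)  with ∈-update⁻ p y x∈
... | inj₁ refl = inj₁ refl
... | inj₂ x∈p  = inj₂ (there x∈p)

module _ {A : Set} where

  ∈-take⁻ : ∀ {x : A} k xs → x ∈ take k xs → x ∈ xs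
  ∈-take⁻ k xs x∈ = subst (_ ∈_) (take++drop≡id k xs) (∈-++⁺ˡ x∈)

  ∈-drop⁻ : ∀ {x : A} k xs → x ∈ drop k xs → x ∈ xs
  ∈-drop⁻ k xs x∈ = subst (_ ∈_) (take++drop≡id k xs) (∈-++⁺ʳ (take k xs) x∈)

  take-drop-disjoint : ∀ {x : A} k {xs} → Unique xs → x ∈ take k xs → x ∉ drop k xs
  take-drop-disjoint (suc k) {y ∷ xs} u       (here refl) = Unique[x∷xs]⇒x∉xs u ∘ ∈-drop⁻ k xs
  take-drop-disjoint (suc k) {y ∷ xs} (_ ∷ u) (there x∈)  = take-drop-disjoint k u x∈

  ∈-take-+⁻ : ∀ {x : A} m k xs → x ∈ take (m + k) xs → x ∈ take m xs ⊎ x ∈ take k (drop m xs)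
  ∈-take-+⁻ zero    k xs       x∈          = inj₂ x∈
  ∈-take-+⁻ (suc m) k (y ∷ xs) (here refl) = inj₁ (here refl)
  ∈-take-+⁻ (suc m) k (y ∷ xs) (there x∈)  with ∈-take-+⁻ m k xs x∈
  ... | inj₁ x∈ʳ = inj₁ (there x∈ʳ)
  ... | inj₂ x∈ʳ = inj₂ x∈ʳ

  ∈-take-zip : ∀ {w : A} k vs ws → length ws ≤ length vs → w ∈ take k ws →
               Σ A λ v → v ∈ take k vs × (v , w) ∈ zip vs ws
  ∈-take-zip (suc k) (v ∷ vs) (w ∷ ws) _          (here refl) = v , here refl , here refl
  ∈-take-zip (suc k) (v ∷ vs) (w ∷ ws) (s≤s len≤) (there w∈)
    with ∈-take-zip k vs ws len≤ w∈
  ... | u , u∈ , uw∈ = u , there u∈ , there uw∈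

  drop-suc : ∀ k {xs ys} {y : A} → drop k xs ≡ y ∷ ys → drop (suc k) xs ≡ ys
  drop-suc zero    {y ∷ xs} refl = refl
  drop-suc (suc k) {x ∷ xs} eq   = drop-suc k eq

4xy≤[x+y]² : ∀ x y → 4 * (x * y) ≤ (x + y) * (x + y)
4xy≤[x+y]² x y = [ ordered , (λ y≤x → swap {y} {x} (ordered y≤x)) ]′ (≤-total x y)
  where
  square-gap : ∀ x e → 4 * (x * (x + e)) + e * e ≡ (x + (x + e)) * (x + (x + e))
  square-gap = solve-∀
  ordered : ∀ {x y} → x ≤ y → 4 * (x * y) ≤ (x + y) * (x + y)
  ordered {x} {y} x≤y = subst (λ y → 4 * (x * y) ≤ (x + y) * (x + y)) (m+[n∸m]≡n x≤y)
    (subst (4 * (x * (x + (y ∸ x))) ≤_) (square-gap x (y ∸ x)) (m≤m+n _ ((y ∸ x) * (y ∸ x))))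
  swap : ∀ {x y} → 4 * (x * y) ≤ (x + y) * (x + y) → 4 * (y * x) ≤ (y + x) * (y + x)
  swap {x} {y} = subst₂ _≤_ (cong (4 *_) (*-comm x y)) (cong₂ _*_ (+-comm x y) (+-comm x y))

⌈2√a⌉≤d+s : ∀ {a c} → CeilTwoSqrt a c → ∀ {d s} → a ≤ s * d → c ≤ d + s
⌈2√a⌉≤d+s {a} (_ , least) {d} {s} a≤sd = least (d + s) (begin
  4 * a              ≤⟨ *-monoʳ-≤ 4 a≤sd ⟩
  4 * (s * d)        ≡⟨ cong (4 *_) (*-comm s d) ⟩
  4 * (d * s)        ≤⟨ 4xy≤[x+y]² d s ⟩
  (d + s) * (d + s)  ∎)
  where open ≤-Reasoning

⌈2√a⌉≤1+a : ∀ {a c} → CeilTwoSqrt a c → c ≤ suc a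
⌈2√a⌉≤1+a {a} (_ , least) =
  least (suc a) (subst (λ x → 4 * x ≤ suc a * suc a) (*-identityˡ a) (4xy≤[x+y]² 1 a))

halves : ∀ c → ∃[ q ] (c ≡ q + q ⊎ c ≡ suc (q + q))
halves zero = 0 , inj₁ refl
halves (suc c) with halves c
... | q , inj₁ refl = q , inj₂ refl
... | q , inj₂ refl = suc q , inj₁ (cong suc (sym (+-suc q q)))

4a≤4m+1⇒a≤m : ∀ {a m} → 4 * a ≤ 4 * m + 1 → a ≤ m
4a≤4m+1⇒a≤m {a} {m} 4a≤4m+1 with a ≤? m
... | yes a≤m = a≤m
... | no  a≰m = contradiction (+-cancelˡ-≤ (4 * m) 4 1 (begin
  4 * m + 4  ≡⟨ trans (+-comm (4 * m) 4) (sym (*-suc 4 m)) ⟩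
  4 * suc m  ≤⟨ *-monoʳ-≤ 4 (≰⇒> a≰m) ⟩
  4 * a      ≤⟨ 4a≤4m+1 ⟩
  4 * m + 1  ∎)) λ { (s≤s ()) }
  where open ≤-Reasoning

⌈2√a⌉-split : ∀ {a c} → 1 ≤ a → CeilTwoSqrt a c →
              ∃[ b ] ∃[ t ] suc b ≤ a × a ≤ suc t * suc b × suc b + suc t ≡ c
⌈2√a⌉-split {a} {c} 1≤a ceil@(4a≤c² , _) with halves c
... | zero , inj₁ refl = contradiction (≤-trans (*-monoʳ-≤ 4 1≤a) 4a≤c²) λ ()
... | zero , inj₂ refl = contradiction (≤-trans (*-monoʳ-≤ 4 1≤a) 4a≤c²) λ { (s≤s ()) }
... | suc b , inj₁ refl =
  b , b , ≤-trans (m≤n+m (suc b) b) (≤-pred (⌈2√a⌉≤1+a ceil)) ,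
  *-cancelˡ-≤ 4 (subst (4 * a ≤_) (even-square (suc b)) 4a≤c²) , refl
  where
  even-square : ∀ q → (q + q) * (q + q) ≡ 4 * (q * q)
  even-square = solve-∀
... | suc b , inj₂ refl =
  b , suc b , ≤-trans (m≤m+n (suc b) (suc b)) (≤-pred (⌈2√a⌉≤1+a ceil)) ,
  4a≤4m+1⇒a≤m (subst (4 * a ≤_) (odd-square (suc b)) 4a≤c²) , +-suc (suc b) (suc b)
  where
  odd-square : ∀ q → suc (q + q) * suc (q + q) ≡ 4 * (suc q * q) + 1
  odd-square = solve-∀

decay : (m : ℕ → ℕ) (d : ℕ) → (∀ r → m r ≤ m (suc r) + d) → ∀ r → m 0 ≤ m r + r * d
decay m d loss zero    = m≤m+n (m 0) 0
decay m d loss (suc r) = begin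
  m 0                    ≤⟨ decay m d loss r ⟩
  m r + r * d            ≤⟨ +-monoˡ-≤ (r * d) (loss r) ⟩
  m (suc r) + d + r * d  ≡⟨ +-assoc (m (suc r)) d (r * d) ⟩
  m (suc r) + suc r * d  ∎
  where open ≤-Reasoning

decay-step : ∀ {m m₀ m′ k a} → m ≤ m₀ → m₀ ≤ m′ + k → (1 ≤ m → 1 ≤ k → k + m ≤ a) →
             m ≤ m′ + (a ∸ m₀)
decay-step {zero} _ _ _ = z≤n
decay-step {suc m} {m₀} {m′} {zero} m≤m₀ m₀≤m′ _ = begin
  suc m          ≤⟨ m≤m₀ ⟩
  m₀             ≤⟨ m₀≤m′ ⟩
  m′ + 0         ≤⟨ +-monoʳ-≤ m′ z≤n ⟩
  m′ + (_ ∸ m₀)  ∎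
  where open ≤-Reasoning
decay-step {suc m} {m₀} {m′} {suc k} {a} _ m₀≤m′+k k+m≤a =
  ≤-trans (m+n≤o⇒m≤o∸n (suc m) m+m₀≤m′+a) (m≤n+o⇒m∸n≤o (m′ + a) m₀ m′+a≤m₀+m′+d)
  where
  open ≤-Reasoning
  m+m₀≤m′+a : suc m + m₀ ≤ m′ + a
  m+m₀≤m′+a = begin
    suc m + m₀            ≤⟨ +-monoʳ-≤ (suc m) m₀≤m′+k ⟩
    suc m + (m′ + suc k)  ≡⟨ x∙yz≈y∙zx (suc m) m′ (suc k) ⟩
    m′ + (suc k + suc m)  ≤⟨ +-monoʳ-≤ m′ (k+m≤a (s≤s z≤n) (s≤s z≤n)) ⟩
    m′ + a                ∎
  m′+a≤m₀+m′+d : m′ + a ≤ m₀ + (m′ + (a ∸ m₀))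
  m′+a≤m₀+m′+d = begin
    m′ + a                ≤⟨ +-monoʳ-≤ m′ (m≤n+m∸n a m₀) ⟩
    m′ + (m₀ + (a ∸ m₀))  ≡⟨ x∙yz≈y∙xz m′ m₀ (a ∸ m₀) ⟩
    m₀ + (m′ + (a ∸ m₀))  ∎

c+κ∸1≤b+t : ∀ {α c κ b m₀ t} → CeilTwoSqrt α c → m₀ ≤ t * (α ∸ m₀) → b + m₀ ≡ κ + α →
            c + κ ∸ 1 ≤ b + t
c+κ∸1≤b+t {α} {c} {κ} {b} {m₀} {t} ceil m₀≤td b+m₀≡κ+α = begin
  c + κ ∸ 1          ≤⟨ ∸-monoˡ-≤ 1 (+-monoˡ-≤ κ (⌈2√a⌉≤d+s ceil {d} {suc t} α≤[1+t]d)) ⟩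
  d + suc t + κ ∸ 1  ≡⟨ cong (_∸ 1) (shuffle d t κ) ⟩
  κ + d + t          ≡⟨ cong (_+ t) (sym b≡κ+d) ⟩
  b + t              ∎
  where
  open ≤-Reasoning
  d = α ∸ m₀
  shuffle : ∀ d t κ → d + suc t + κ ≡ suc (κ + d + t)
  shuffle = solve-∀
  m₀≤α : m₀ ≤ α
  m₀≤α with m₀ ≤? α
  ... | yes m₀≤α = m₀≤α
  ... | no  m₀≰α = ≤-trans (subst (λ d → m₀ ≤ t * d) (m≤n⇒m∸n≡0 (<⇒≤ (≰⇒> m₀≰α))) m₀≤td)
                           (≤-trans (≤-reflexive (*-zeroʳ t)) z≤n)
  α≤[1+t]d : α ≤ suc t * d
  α≤[1+t]d = begin
    α          ≡⟨ sym (m+[n∸m]≡n m₀≤α) ⟩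
    m₀ + d     ≤⟨ +-monoˡ-≤ d m₀≤td ⟩
    t * d + d  ≡⟨ +-comm (t * d) d ⟩
    suc t * d  ∎
  b≡κ+d : b ≡ κ + d
  b≡κ+d = +-cancelʳ-≡ m₀ b (κ + d) (begin-equality
    b + m₀        ≡⟨ b+m₀≡κ+α ⟩
    κ + α         ≡⟨ cong (κ +_) (sym (m∸n+n≡m m₀≤α)) ⟩
    κ + (d + m₀)  ≡⟨ sym (+-assoc κ d m₀) ⟩
    κ + d + m₀    ∎)

-- Separators

module _ {n : ℕ} (G : Graph n) where

  Reach-closed : ∀ {S X : Subset n} →
                 (∀ {u w} → u ∈ₛ X → adj G u w ≡ true → w ∉ₛ S → w ∈ₛ X) →
                 ∀ {u v} → Reach G S u v → u ∈ₛ X → v ∈ₛ X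
  Reach-closed closed here                u∈X = u∈X
  Reach-closed closed (step uw w∉S reach) u∈X = Reach-closed closed reach (closed u∈X uw w∉S)

  separated-sets-bound : ∀ {κ} → VertexConnectivity G κ → (X W : Subset n) →
    Nonempty X → Nonempty W → (∀ {x} → x ∈ₛ X → x ∉ₛ W) →
    (∀ {x u} → x ∈ₛ X → adj G x u ≡ true → u ∉ₛ W) →
    κ + (∣ X ∣ + ∣ W ∣) ≤ n
  separated-sets-bound {κ} (_ , minimal) X W (x , x∈X) (w , w∈W) disjoint no-edge =
    m≤o∸n⇒m+n≤o κ (subst (_≤ n) ∣X∪W∣≡ (∣p∣≤n (X ∪ W))) (begin
      κ                    ≤⟨ minimal S separating ⟩
      ∣ S ∣                ≡⟨ ∣∁p∣≡n∸∣p∣ (X ∪ W) ⟩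
      n ∸ ∣ X ∪ W ∣        ≡⟨ cong (n ∸_) ∣X∪W∣≡ ⟩
      n ∸ (∣ X ∣ + ∣ W ∣)  ∎)
    where
    open ≤-Reasoning
    S = ∁ (X ∪ W)
    ∣X∪W∣≡ : ∣ X ∪ W ∣ ≡ ∣ X ∣ + ∣ W ∣
    ∣X∪W∣≡ = ∣p∪q∣≡∣p∣+∣q∣ X W disjoint
    closed : ∀ {u v} → u ∈ₛ X → adj G u v ≡ true → v ∉ₛ S → v ∈ₛ X
    closed u∈X uv v∉S with x∈p∪q⁻ X W (x∉∁p⇒x∈p v∉S)
    ... | inj₁ v∈X = v∈X
    ... | inj₂ v∈W = contradiction v∈W (no-edge u∈X uv)
    separating : Separating G S
    separating = inj₁ (x , w , x∈p⇒x∉∁p (x∈p∪q⁺ (inj₁ x∈X)) , x∈p⇒x∉∁p (x∈p∪q⁺ (inj₂ w∈W)) ,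
                       λ reach → disjoint (Reach-closed closed reach x∈X) w∈W)

-- Hopping forcing

module _ {n : ℕ} (G : Graph n) where

  forcer-unused : ∀ {S used L v w} → Chron G S used L → (v , w) ∈ L → v ∉ used
  forcer-unused (step (_ , v∉used , _) _) (here refl)  = v∉used
  forcer-unused (step _ chron)            (there vw∈L) = forcer-unused chron vw∈L ∘ there

  forcers-distinct : ∀ {S used L} → Chron G S used L → AllPairs (_≢_ on proj₁) L
  forcers-distinct (done _)       = []
  forcers-distinct (step _ chron) =
    All.tabulate (λ vw∈L v≡ → forcer-unused chron vw∈L (here (sym v≡))) ∷ forcers-distinct chron

module _ {n : ℕ} (G : Graph n) (B : Subset n) (L : List (Fin n × Fin n)) where

  open import Data.List.Membership.DecPropositional (≡-dec (_≟_ {n}) (_≟_ {n}))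
    using () renaming (_∈?_ to _∈ᴸ?_)

  Saturated : ℕ → Fin n → Set
  Saturated t v = BlueBy G B L t v × (∀ u → adj G v u ≡ true → BlueBy G B L t u)

  blue? : ∀ t → Decidable (BlueBy G B L t)
  blue? zero    w = w ∈? B
  blue? (suc t) w = blue? t w ⊎-dec any? λ v → (v , w) ∈ᴸ? L ×-dec blue? t v ×-dec
    all? (λ u → adj G v u Bool.≟ true →-dec blue? t u) ×-dec ¬? (blue? t w)

  saturated? : ∀ t → Decidable (Saturated t)
  saturated? t v = blue? t v ×-dec all? (λ u → adj G v u Bool.≟ true →-dec blue? t u)

  initially-blue : ∀ {w} → w ∈ₛ B → ∀ t → BlueBy G B L t w
  initially-blue w∈B zero    = w∈B
  initially-blue w∈B (suc t) = inj₁ (initially-blue w∈B t)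

  saturated-suc : ∀ {t v} → Saturated t v → Saturated (suc t) v
  saturated-suc (v-blue , nbrs-blue) = inj₁ v-blue , λ u uv → inj₁ (nbrs-blue u uv)

  force : ∀ {t v w} → (v , w) ∈ L → Saturated t v → BlueBy G B L (suc t) w
  force {t} {v} {w} vw∈L (v-blue , nbrs-blue) with blue? t w
  ... | yes w-blue  = inj₁ w-blue
  ... | no  w-white = inj₂ (v , vw∈L , v-blue , nbrs-blue , w-white)

  forced-by-saturated : ∀ t {w} → BlueBy G B L (suc t) w → w ∉ₛ B →
                        ∃[ v ] (v , w) ∈ L × Saturated t v
  forced-by-saturated t (inj₂ (v , vw∈L , v-blue , nbrs-blue , _)) _ = v , vw∈L , v-blue , nbrs-blue
  forced-by-saturated zero    (inj₁ w∈B)    w∉B = contradiction w∈B w∉B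
  forced-by-saturated (suc t) (inj₁ w-blue) w∉B with forced-by-saturated t w-blue w∉B
  ... | v , vw∈L , v-saturated = v , vw∈L , saturated-suc v-saturated

-- The lower bound

module _ {n : ℕ} (G : Graph n) (B : Subset n) (L : List (Fin n × Fin n)) where

  Blue : ℕ → Subset n
  Blue t = ⟦ blue? G B L t ⟧

  Saturatedₛ : ℕ → Subset n
  Saturatedₛ t = ⟦ saturated? G B L t ⟧

  whites : ℕ → ℕ
  whites t = ∣ ∁ (Blue t) ∣

  newly? : ∀ t → Decidable (λ w → BlueBy G B L (suc t) w × w ∉ₛ B)
  newly? t w = blue? G B L (suc t) w ×-dec ¬? (w ∈? B)

  Newly : ℕ → Subset n
  Newly t = ⟦ newly? t ⟧

  whites≤whites₀ : ∀ t → whites t ≤ whites 0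
  whites≤whites₀ t = p⊆q⇒∣p∣≤∣q∣ λ x∈ → x∉p⇒x∈∁p λ x∈B →
    x∈∁p⇒x∉p x∈ (∈⟦⟧⁺ (blue? G B L t) (initially-blue G B L (∈⟦⟧⁻ (blue? G B L 0) x∈B) t))

  whites₀≤whites+newly : ∀ t → whites 0 ≤ whites (suc t) + ∣ Newly t ∣
  whites₀≤whites+newly t =
    ≤-trans (p⊆q⇒∣p∣≤∣q∣ split) (∣p∪q∣≤∣p∣+∣q∣ (∁ (Blue (suc t))) (Newly t))
    where
    split : ∁ (Blue 0) ⊆ ∁ (Blue (suc t)) ∪ Newly t
    split {x} x∈ with blue? G B L (suc t) x
    ... | no  white = x∈p∪q⁺ (inj₁ (x∉p⇒x∈∁p (white ∘ ∈⟦⟧⁻ (blue? G B L (suc t)))))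
    ... | yes blue  = x∈p∪q⁺ (inj₂ (∈⟦⟧⁺ (newly? t) (blue , x∈∁p⇒x∉p x∈ ∘ ∈⟦⟧⁺ (blue? G B L 0))))

  completes⇒whites≡0 : ∀ {t} → CompletesBy G B L t → whites t ≡ 0
  completes⇒whites≡0 {t} complete = trans (cong ∣_∣ (Empty-unique empty)) (∣⊥∣≡0 n)
    where
    empty : Empty (∁ (Blue t))
    empty (x , x∈) = x∈∁p⇒x∉p x∈ (∈⟦⟧⁺ (blue? G B L t) (complete x))

  ∣B∣+whites₀≡n : ∣ B ∣ + whites 0 ≡ n
  ∣B∣+whites₀≡n = trans (cong (λ p → ∣ p ∣ + whites 0) B≡Blue₀) (∣p∣+∣∁p∣≡n (Blue 0))
    where
    B≡Blue₀ : B ≡ Blue 0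
    B≡Blue₀ = ⊆-antisym (∈⟦⟧⁺ (blue? G B L 0)) (∈⟦⟧⁻ (blue? G B L 0))

  module _ (chron : ChronListOf G B L) where

    ∣Newly∣≤∣Saturated∣ : ∀ t → ∣ Newly t ∣ ≤ ∣ Saturatedₛ t ∣
    ∣Newly∣≤∣Saturated∣ t = begin
      ∣ Newly t ∣                  ≤⟨ p⊆q⇒∣p∣≤∣q∣ covered ⟩
      ∣ fromList (map proj₂ L′) ∣  ≤⟨ ∣fromList∣≤length (map proj₂ L′) ⟩
      length (map proj₂ L′)        ≡⟨ trans (length-map proj₂ L′) (sym (length-map proj₁ L′)) ⟩
      length (map proj₁ L′)        ≡⟨ sym (∣fromList∣≡length distinct) ⟩
      ∣ fromList (map proj₁ L′) ∣  ≤⟨ p⊆q⇒∣p∣≤∣q∣ forcers-saturated ⟩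
      ∣ Saturatedₛ t ∣             ∎
      where
      open ≤-Reasoning
      L′ = filter (saturated? G B L t ∘ proj₁) L
      distinct : Unique (map proj₁ L′)
      distinct = AllPairs.map⁺ (AllPairs.filter⁺ _ (forcers-distinct G chron))
      covered : Newly t ⊆ fromList (map proj₂ L′)
      covered x∈ with ∈⟦⟧⁻ (newly? t) x∈
      ... | blue , x∉B with forced-by-saturated G B L t blue x∉B
      ... | v , vx∈L , v-saturated =
        ∈-fromList⁺ (∈-map⁺ proj₂ (∈-filter⁺ (saturated? G B L t ∘ proj₁) vx∈L v-saturated))
      forcers-saturated : fromList (map proj₁ L′) ⊆ Saturatedₛ t
      forcers-saturated x∈ with ∈-map⁻ proj₁ (∈-fromList⁻ (map proj₁ L′) x∈)
      ... | _ , vw∈L′ , refl = ∈⟦⟧⁺ (saturated? G B L t)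
        (proj₂ (∈-filter⁻ (saturated? G B L t ∘ proj₁) {xs = L} vw∈L′))

    module _ {κ α : ℕ} (connectivity : VertexConnectivity G κ) (κ+α≡n : κ + α ≡ n) where

      ∣Saturated∣+whites≤α : ∀ t → 0 < ∣ Saturatedₛ t ∣ → 0 < whites t →
                              ∣ Saturatedₛ t ∣ + whites t ≤ α
      ∣Saturated∣+whites≤α t 0<∣Saturated∣ 0<whites =
        +-cancelˡ-≤ κ _ _ (subst (κ + (∣ Saturatedₛ t ∣ + whites t) ≤_) (sym κ+α≡n)
          (separated-sets-bound G connectivity (Saturatedₛ t) (∁ (Blue t))
            (0<∣p∣⇒Nonempty _ 0<∣Saturated∣) (0<∣p∣⇒Nonempty _ 0<whites)
            (λ x∈ → x∈p⇒x∉∁p (∈⟦⟧⁺ (blue? G B L t) (proj₁ (saturated x∈))))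
            (λ x∈ xu → x∈p⇒x∉∁p (∈⟦⟧⁺ (blue? G B L t) (proj₂ (saturated x∈) _ xu)))))
        where
        saturated : ∀ {x} → x ∈ₛ Saturatedₛ t → Saturated G B L t x
        saturated = ∈⟦⟧⁻ (saturated? G B L t)

      whites-decay : ∀ t → whites t ≤ whites (suc t) + (α ∸ whites 0)
      whites-decay t = decay-step (whites≤whites₀ t) (whites₀≤whites+newly t) λ 0<whites 0<∣Newly∣ →
        ≤-trans (+-monoˡ-≤ (whites t) (∣Newly∣≤∣Saturated∣ t))
                (∣Saturated∣+whites≤α t (≤-trans 0<∣Newly∣ (∣Newly∣≤∣Saturated∣ t)) 0<whites)

      throttling-lower-bound : ∀ {c t} → CeilTwoSqrt α c → CompletesBy G B L t →
                               c + κ ∸ 1 ≤ ∣ B ∣ + t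
      throttling-lower-bound {c} {t} ceil complete =
        c+κ∸1≤b+t ceil whites₀≤t[α∸whites₀] (trans ∣B∣+whites₀≡n (sym κ+α≡n))
        where
        whites₀≤t[α∸whites₀] : whites 0 ≤ t * (α ∸ whites 0)
        whites₀≤t[α∸whites₀] = subst (λ m → whites 0 ≤ m + t * (α ∸ whites 0))
                                     (completes⇒whites≡0 complete)
                                     (decay whites (α ∸ whites 0) whites-decay t)

-- The upper bound

module _ {n : ℕ} (G : Graph n) where

  shifted-forces-chron : ∀ b (fs : List (Fin n)) (S : Subset n) used → Unique fs →
    (∀ {v u} → v ∈ fs → adj G v u ≡ true → u ∉ fs) →
    (∀ {v} → v ∈ fs → v ∉ used) →
    (∀ {w} → w ∉ drop (suc b) fs → w ∈ₛ S) →
    (∀ {w} → w ∈ drop (suc b) fs → w ∉ₛ S) →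
    Chron G S used (zip fs (drop (suc b) fs))
  shifted-forces-chron b [] S used _ _ _ blue _ = done λ _ w (_ , _ , _ , w∉S) → w∉S (blue λ ())
  shifted-forces-chron b (x ∷ fs) S used x∷fs-unique@(_ ∷ fs-unique) independent fresh blue white
    with drop b fs in later≡
  ... | []     = done λ _ w (_ , _ , _ , w∉S) → w∉S (blue λ ())
  ... | y ∷ ys = step valid (subst (Chron G (S [ y ]≔ inside) (x ∷ used) ∘ zip fs) ys≡ rest)
    where
    ys≡ : drop (suc b) fs ≡ ys
    ys≡ = drop-suc b later≡
    in-fs : ∀ {w} → w ∈ y ∷ ys → w ∈ fs
    in-fs w∈ = ∈-drop⁻ b fs (subst (_ ∈_) (sym later≡) w∈)
    y∉ys : y ∉ ys
    y∉ys = Unique[x∷xs]⇒x∉xs (subst Unique later≡ (drop⁺ b fs-unique))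
    valid : ValidForce G S used x y
    valid = blue (Unique[x∷xs]⇒x∉xs x∷fs-unique ∘ in-fs) , fresh (here refl) ,
            (λ u xu → blue (independent (here refl) xu ∘ there ∘ in-fs)) , white (here refl)
    blue′ : ∀ {w} → w ∉ drop (suc b) fs → w ∈ₛ S [ y ]≔ inside
    blue′ {w} w∉ with w ≟ y
    ... | yes refl = []≔-updates S y
    ... | no  w≢y  = []≔-minimal S w y w≢y (blue λ
      { (here w≡y)   → w≢y w≡y
      ; (there w∈ys) → w∉ (subst (w ∈_) (sym ys≡) w∈ys) })
    white′ : ∀ {w} → w ∈ drop (suc b) fs → w ∉ₛ S [ y ]≔ inside
    white′ {w} w∈ w∈S′ with ∈-update⁻ S y w∈S′
    ... | inj₁ refl = y∉ys (subst (y ∈_) ys≡ w∈)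
    ... | inj₂ w∈S  = white (there (subst (w ∈_) ys≡ w∈)) w∈S
    rest : Chron G (S [ y ]≔ inside) (x ∷ used) (zip fs (drop (suc b) fs))
    rest = shifted-forces-chron b fs (S [ y ]≔ inside) (x ∷ used) fs-unique
      (λ v∈ vu u∈ → independent (there v∈) vu (there u∈))
      (λ { v∈ (here refl)      → Unique[x∷xs]⇒x∉xs x∷fs-unique v∈
         ; v∈ (there v∈used) → fresh (there v∈) v∈used })
      blue′ white′

  module ShiftedForcing (xs : List (Fin n)) (xs-unique : Unique xs)
    (xs-independent : ∀ {v u} → v ∈ xs → adj G v u ≡ true → u ∉ xs) (b : ℕ) where

    open import Data.List.Membership.DecPropositional (_≟_ {n}) using () renaming (_∈?_ to _∈ᴸ?_)

    B : Subset n
    B = ∁ (fromList (drop (suc b) xs))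

    L : List (Fin n × Fin n)
    L = zip xs (drop (suc b) xs)

    ∈B : ∀ {w} → w ∉ drop (suc b) xs → w ∈ₛ B
    ∈B w∉ = x∉p⇒x∈∁p (w∉ ∘ ∈-fromList⁻ _)

    chron : ChronListOf G B L
    chron = shifted-forces-chron b xs B [] xs-unique xs-independent (λ _ ()) ∈B
                                 (x∈p⇒x∉∁p ∘ ∈-fromList⁺)

    ∣B∣≡ : ∣ B ∣ ≡ n ∸ (length xs ∸ suc b)
    ∣B∣≡ = trans (∣∁p∣≡n∸∣p∣ (fromList (drop (suc b) xs)))
      (cong (n ∸_) (trans (∣fromList∣≡length (drop⁺ (suc b) xs-unique)) (length-drop (suc b) xs)))

    blue-by-prefix : ∀ r {w} → w ∈ take (suc r * suc b) xs → BlueBy G B L r w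
    blue-by-prefix r {w} w∈ with ∈-take-+⁻ (suc b) (r * suc b) xs w∈
    ... | inj₁ w∈prefix =
      initially-blue G B L (∈B (take-drop-disjoint (suc b) xs-unique w∈prefix)) r
    blue-by-prefix zero    _ | inj₂ ()
    blue-by-prefix (suc r) _ | inj₂ w∈later
      with ∈-take-zip (suc r * suc b) xs (drop (suc b) xs)
             (subst (_≤ length xs) (sym (length-drop (suc b) xs)) (m∸n≤m (length xs) (suc b)))
             w∈later
    ... | v , v∈ , vw∈L = force G B L vw∈L (blue-by-prefix r v∈ , λ u vu →
      initially-blue G B L (∈B (xs-independent (∈-take⁻ _ xs v∈) vu ∘ ∈-drop⁻ (suc b) xs)) r)

    completes : ∀ {t} → length xs ≤ suc t * suc b → CompletesBy G B L t
    completes {t} len≤ w with w ∈ᴸ? xs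
    ... | yes w∈xs = blue-by-prefix t (subst (w ∈_) (sym (take-all _ xs len≤)) w∈xs)
    ... | no  w∉xs = initially-blue G B L (∈B (w∉xs ∘ ∈-drop⁻ (suc b) xs)) t

  throttling-upper-bound : ∀ {I κ α c} → Independent G I → ∣ I ∣ ≡ α → 1 ≤ α → κ + α ≡ n →
    CeilTwoSqrt α c →
    ∃[ B ] ∃[ L ] ∃[ t ] ChronListOf G B L × CompletesBy G B L t × ∣ B ∣ + t ≡ c + κ ∸ 1
  throttling-upper-bound {I} {κ} {α} independent ∣I∣≡α 1≤α κ+α≡n ceil
    with ⌈2√a⌉-split 1≤α ceil
  ... | b , t , 1+b≤α , α≤[1+t][1+b] , refl =
    B , L , t , chron , completes (subst (_≤ suc t * suc b) (sym length-xs) α≤[1+t][1+b]) , size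
    where
    xs = filter (_∈? I) (allFin n)
    in-I : ∀ {v} → v ∈ xs → v ∈ₛ I
    in-I = proj₂ ∘ ∈-filter⁻ (_∈? I) {xs = allFin n}
    xs-independent : ∀ {v u} → v ∈ xs → adj G v u ≡ true → u ∉ xs
    xs-independent v∈ vu u∈ =
      contradiction (trans (sym vu) (independent _ _ (in-I v∈) (in-I u∈))) λ ()
    length-xs : length xs ≡ α
    length-xs = begin
      length xs        ≡⟨ sym (∣fromList∣≡length (filter⁺ (_∈? I) (allFin⁺ n))) ⟩
      ∣ fromList xs ∣  ≡⟨ cong ∣_∣ (⊆-antisym (in-I ∘ ∈-fromList⁻ xs)
                                            (∈-fromList⁺ ∘ ∈-filter⁺ (_∈? I) (∈-allFin _))) ⟩
      ∣ I ∣            ≡⟨ ∣I∣≡α ⟩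
      α                ∎
      where open ≡-Reasoning
    open ShiftedForcing xs (filter⁺ (_∈? I) (allFin⁺ n)) xs-independent b
    shuffle : ∀ κ b t → κ + suc b + t ≡ b + suc t + κ
    shuffle = solve-∀
    size : ∣ B ∣ + t ≡ suc b + suc t + κ ∸ 1
    size = begin
      ∣ B ∣ + t                        ≡⟨ cong (_+ t) ∣B∣≡ ⟩
      n ∸ (length xs ∸ suc b) + t      ≡⟨ cong₂ (λ m l → m ∸ (l ∸ suc b) + t) (sym κ+α≡n) length-xs ⟩
      κ + α ∸ (α ∸ suc b) + t          ≡⟨ cong (_+ t) (trans (+-∸-assoc κ (m∸n≤m α (suc b)))
                                                             (cong (κ +_) (m∸[m∸n]≡n 1+b≤α))) ⟩
      κ + suc b + t                    ≡⟨ shuffle κ b t ⟩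
      suc b + suc t + κ ∸ 1            ∎
      where open ≡-Reasoning

lemma3p12 : (n : ℕ) (G : Graph n) (κ α : ℕ) →
    1 ≤ n → VertexConnectivity G κ → IndependenceNumber G α → κ + α ≡ n →
    (c₁ c₂ : ℕ) → CeilTwoSqrt (n ∸ κ) c₁ → CeilTwoSqrt α c₂ →
    HoppingThrottling G (c₁ + κ ∸ 1) × HoppingThrottling G (n ∸ α + c₂ ∸ 1)
lemma3p12 n G κ α 1≤n connectivity ((I , independent , ∣I∣≡α) , maximum) κ+α≡n c₁ c₂ ceil₁ ceil₂ =
  throttling (subst (λ m → CeilTwoSqrt m c₁) n∸κ≡α ceil₁) ,
  subst (HoppingThrottling G) (cong (_∸ 1) (trans (+-comm c₂ κ) (cong (_+ c₂) (sym n∸α≡κ))))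
        (throttling ceil₂)
  where
  n∸κ≡α : n ∸ κ ≡ α
  n∸κ≡α = trans (cong (_∸ κ) (sym κ+α≡n)) (m+n∸m≡n κ α)
  n∸α≡κ : n ∸ α ≡ κ
  n∸α≡κ = trans (cong (_∸ α) (sym κ+α≡n)) (m+n∸n≡m κ α)
  vertex : Fin n
  vertex = fromℕ< 1≤n
  1≤α : 1 ≤ α
  1≤α = subst (_≤ α) (∣⁅x⁆∣≡1 vertex) (maximum ⁅ vertex ⁆ λ u v u∈ v∈ →
    subst₂ (λ u v → adj G u v ≡ false) (sym (x∈⁅y⁆⇒x≡y vertex u∈)) (sym (x∈⁅y⁆⇒x≡y vertex v∈))
           (irrefl G vertex))
  throttling : ∀ {c} → CeilTwoSqrt α c → HoppingThrottling G (c + κ ∸ 1)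
  throttling ceil = throttling-upper-bound G independent ∣I∣≡α 1≤α κ+α≡n ceil ,
    λ B L t chron complete → throttling-lower-bound G B L chron connectivity κ+α≡n ceil complete
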